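{- For every cut-free derivation $\mathcal{D}\triangleleft\Gamma\vdash M:B$ in $\mathsf{IMLL}_2$ which contains no application of $\forall\mathrm{L}$, the following inequalities hold: $|M|\leq|M^\Gamma_B|\leq|\Gamma^-|+|B^-|\leq 2\cdot|M^\Gamma_B|$.
   Context: $\mathsf{IMLL}_2$: types $A ::= \alpha\mid A\multimap A\mid\forall\alpha.A$; type-assignment to linear $\lambda$-terms with rules (ax) $x:A\vdash x:A$; (cut) from $\Gamma\vdash N:A$, $\Delta,x:A\vdash M:C$ infer $\Gamma,\Delta\vdash M[N/x]:C$; ($\multimap$R) from $\Gamma,x:A\vdash M:B$ infer $\Gamma\vdash\lambda x.M:A\multimap B$; ($\multimap$L) from $\Gamma\vdash N:A$, $\Delta,x:B\vdash M:C$ infer $\Gamma,\Delta,y:A\multimap B\vdash M[yN/x]:C$ (disjoint domains); ($\forall$R) from $\Gamma\vdash M:A\langle\gamma/\alpha\rangle$, $\gamma$ not free in $\Gamma$, infer $\Gamma\vdash M:\forall\alpha.A$; ($\forall$L) from $\Gamma,x:A\langle B/\alpha\rangle\vdash M:C$ infer $\Gamma,x:\forall\alpha.A\vdash M:C$. The $\eta$-expansion of a cut-free derivation $\mathcal{D}\triangleleft\Gamma\vdash M:B$ is obtained by replacing every axiom $x:A\vdash x:A$ by the canonical derivation of $x:A\vdash\eta_A(x):A$ all of whose axioms are atomic ($y:\alpha\vdash y:\alpha$), where $\eta_\alpha(N)=N$, $\eta_{\forall\alpha.C}(N)=\eta_C(N)$, $\eta_{C\multimap D}(N)=\lambda y.\eta_D(N\,\eta_C(y))$;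 the subject of its conclusion is the $\eta$-long normal form $M^\Gamma_B$ (so $M^\Gamma_B\rightarrow^*_\eta M$). $A^-$ strips quantifiers: $\alpha^-=\alpha$, $(A\multimap B)^-=A^-\multimap B^-$, $(\forall\alpha.A)^-=A^-\langle\gamma/\alpha\rangle$ with $\gamma$ fresh; for $\Gamma=x_1:A_1,\dots,x_n:A_n$, $|\Gamma^-|=\sum_i|A_i^-|$. Sizes of types and terms are numbers of nodes of their syntax trees. -}

module Defs where

open import Data.Nat using (ℕ; zero; suc; _+_; _⊔_; _≟_)
open import Data.Fin using (Fin; inject₁) renaming (zero to fz; suc to fs)
open import Data.List using (List; []; _∷_; _++_; map; concatMap; foldr)
open import Data.List.Membership.Propositional using (_∉_)
open import Data.List.Relation.Unary.Unique.Propositional using (Unique)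
open import Data.List.Relation.Binary.Permutation.Propositional using (_↭_)
open import Data.Vec using (Vec; []; _∷ʳ_; lookup)
open import Data.Product using (_×_; _,_; proj₁; proj₂)
open import Data.Unit using (⊤)
open import Data.Empty using (⊥)
open import Relation.Nullary using (yes; no)

-- Types of IMLL₂ (locally nameless, bound type variables as de Bruijn
-- LEVELS: in  Ty n  there are n enclosing binders; the outermost binder
-- is level fz, the innermost (newest) is level n-1).

data Ty (n : ℕ) : Set where
  fvar : ℕ → Ty n
  bvar : Fin n → Ty n
  _⊸_  : Ty n → Ty n → Ty n
  all  : Ty (suc n) → Ty n

infixr 5 _⊸_

-- one more enclosing binder (levels of existing binders unchanged)
wk1 : ∀ {n} → Ty n → Ty (suc n)
wk1 (fvar a) = fvar a
wk1 (bvar i) = bvar (inject₁ i)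
wk1 (A ⊸ B)  = wk1 A ⊸ wk1 B
wk1 (all A)  = all (wk1 A)

weakenTy : ∀ {n} → Ty 0 → Ty n
weakenTy {zero}  A = A
weakenTy {suc n} A = wk1 (weakenTy A)

-- A⟨B/α⟩ : instantiate the outermost bound variable (level fz) by B
inst : ∀ {n} → Ty (suc n) → Ty 0 → Ty n
inst (fvar a)      B = fvar a
inst (bvar fz)     B = weakenTy B
inst (bvar (fs i)) B = bvar i
inst (A ⊸ C)       B = inst A B ⊸ inst C B
inst (all A)       B = all (inst A B)

ftv : ∀ {n} → Ty n → List ℕ
ftv (fvar a) = a ∷ []
ftv (bvar i) = []
ftv (A ⊸ B)  = ftv A ++ ftv B
ftv (all A)  = ftv A

maxList : List ℕ → ℕ
maxList = foldr _⊔_ 0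

tsize : ∀ {n} → Ty n → ℕ
tsize (fvar a) = 1
tsize (bvar i) = 1
tsize (A ⊸ B)  = suc (tsize A + tsize B)
tsize (all A)  = suc (tsize A)

-- A⁻ : strip quantifiers, replacing each bound variable by a fresh
-- free variable γ (the binder at depth n gets  base + n, where base
-- exceeds every free type variable of the type).
stripEnv : ∀ {n} → ℕ → Vec ℕ n → Ty n → Ty 0
stripEnv base env (fvar a) = fvar a
stripEnv base env (bvar i) = fvar (lookup env i)
stripEnv base env (A ⊸ B)  = stripEnv base env A ⊸ stripEnv base env B
stripEnv {n} base env (all A) = stripEnv base (env ∷ʳ (base + n)) A

_⁻ : Ty 0 → Ty 0
A ⁻ = stripEnv (suc (maxList (ftv A))) [] A

-- Linear λ-terms (locally nameless: free variables named by ℕ,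
-- bound variables de Bruijn indices; this gives α-equivalence and
-- capture-avoiding substitution for free).

data Term : Set where
  fv  : ℕ → Term
  bv  : ℕ → Term
  lam : Term → Term
  app : Term → Term → Term

size : Term → ℕ
size (fv x)    = 1
size (bv i)    = 1
size (lam M)   = suc (size M)
size (app M N) = suc (size M + size N)

closeAt : ℕ → ℕ → Term → Term
closeAt k x (fv y) with x ≟ y
... | yes _ = bv k
... | no  _ = fv y
closeAt k x (bv i)    = bv i
closeAt k x (lam M)   = lam (closeAt (suc k) x M)
closeAt k x (app M N) = app (closeAt k x M) (closeAt k x N)

ƛ_⇒_ : ℕ → Term → Term
ƛ x ⇒ M = lam (closeAt 0 x M)

-- M[N/x]   (N locally closed, so no capture is possible)
_[_/_] : Term → Term → ℕ → Term
fv y [ N / x ] with x ≟ y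
... | yes _ = N
... | no  _ = fv y
bv i      [ N / x ] = bv i
lam M     [ N / x ] = lam (M [ N / x ])
app M M′ [ N / x ] = app (M [ N / x ]) (M′ [ N / x ])

fvs : Term → List ℕ
fvs (fv x)    = x ∷ []
fvs (bv i)    = []
fvs (lam M)   = fvs M
fvs (app M N) = fvs M ++ fvs N

fresh : Term → ℕ
fresh N = suc (maxList (fvs N))

η : ∀ {n} → Ty n → Term → Term
η (fvar a) N = N
η (bvar i) N = N
η (all C)  N = η C N
η (C ⊸ D)  N = ƛ y ⇒ η D (app N (η C (fv y)))
  where y = fresh N

-- Contexts and derivations (contexts are lists taken up to permutation,
-- with pairwise distinct variables).

Ctx : Set
Ctx = List (ℕ × Ty 0)

dom : Ctx → List ℕ
dom = map proj₁

ctxFtv : Ctx → List ℕ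
ctxFtv = concatMap (λ p → ftv (proj₂ p))

data _⊢_∶_ : Ctx → Term → Ty 0 → Set where
  ax   : ∀ x A → ((x , A) ∷ []) ⊢ fv x ∶ A
  cut  : ∀ {Θ Γ Δ N M A C x} →
         Γ ⊢ N ∶ A → ((x , A) ∷ Δ) ⊢ M ∶ C →
         Θ ↭ Γ ++ Δ → Unique (dom Θ) →
         Θ ⊢ M [ N / x ] ∶ C
  ⊸R   : ∀ {Γ M A B x} →
         ((x , A) ∷ Γ) ⊢ M ∶ B →
         Γ ⊢ ƛ x ⇒ M ∶ (A ⊸ B)
  ⊸L   : ∀ {Θ Γ Δ N M A B C x y} →
         Γ ⊢ N ∶ A → ((x , B) ∷ Δ) ⊢ M ∶ C →
         Θ ↭ (y , A ⊸ B) ∷ (Γ ++ Δ) → Unique (dom Θ) →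
         Θ ⊢ M [ app (fv y) N / x ] ∶ C
  ∀R   : ∀ {Γ M} {A : Ty 1} γ →
         Γ ⊢ M ∶ inst A (fvar γ) →
         γ ∉ ctxFtv Γ → γ ∉ ftv (all A) →
         Γ ⊢ M ∶ all A
  ∀L   : ∀ {Γ M C x} {A : Ty 1} (B : Ty 0) →
         ((x , inst A B) ∷ Γ) ⊢ M ∶ C →
         ((x , all A) ∷ Γ) ⊢ M ∶ C

CutFree : ∀ {Γ M C} → Γ ⊢ M ∶ C → Set
CutFree (ax x A)         = ⊤
CutFree (cut _ _ _ _)    = ⊥
CutFree (⊸R d)           = CutFree d
CutFree (⊸L d e _ _)     = CutFree d × CutFree e
CutFree (∀R γ d _ _)     = CutFree d
CutFree (∀L B d)         = CutFree d

No∀L : ∀ {Γ M C} → Γ ⊢ M ∶ C → Set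
No∀L (ax x A)         = ⊤
No∀L (cut d e _ _)    = No∀L d × No∀L e
No∀L (⊸R d)           = No∀L d
No∀L (⊸L d e _ _)     = No∀L d × No∀L e
No∀L (∀R γ d _ _)     = No∀L d
No∀L (∀L B d)         = ⊥

-- subject of the conclusion of the η-expansion of a derivation:
-- every axiom  x:A ⊢ x:A  is replaced by  x:A ⊢ η_A(x):A,
-- and the remaining rules rebuild the subject as before.
ηSubject : ∀ {Γ M C} → Γ ⊢ M ∶ C → Term
ηSubject (ax x A)                  = η A (fv x)
ηSubject (cut {x = x} d e _ _)     = ηSubject e [ ηSubject d / x ]
ηSubject (⊸R {x = x} d)            = ƛ x ⇒ ηSubject d
ηSubject (⊸L {x = x} {y = y} d e _ _) = ηSubject e [ app (fv y) (ηSubject d) / x ]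
ηSubject (∀R γ d _ _)              = ηSubject d
ηSubject (∀L B d)                  = ηSubject d

ηLong : ∀ {Γ M C} → Γ ⊢ M ∶ C → Term
ηLong = ηSubject

ctxMinusSize : Ctx → ℕ
ctxMinusSize []            = 0
ctxMinusSize ((x , A) ∷ Γ) = tsize (A ⁻) + ctxMinusSize Γ

-- In every derivation each variable of the context occurs exactly once in
-- the subject, and also in the subject of the η-expansion, so ⊸L substitutes
-- y N for a single occurrence of x.  Consequently each of the three measures
-- |M|, |M^Γ_B| and |Γ⁻| + |B⁻| grows by exactly one under ⊸R, is one more
-- than the sum of the premises' measures under ⊸L, and is unchanged by ∀R
-- (instantiating by a type variable keeps the number of arrows).  The
-- inequalities are therefore inherited from the axioms x : A ⊢ x : A, where,
-- with k arrows in A, the three measures are 1, 1 + 3k and 2(1 + 2k).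

module Submission where

open import Defs
open import Data.Nat using (ℕ; _+_; _*_; _≤_)
open import Data.Product using (_×_)

open import Data.Nat using (zero; suc; _≟_; s≤s; z≤n)
open import Data.Nat.Properties
open import Data.Nat.ListAction using (sum)
open import Data.Nat.ListAction.Properties using (sum-++; sum-↭)
open import Data.Nat.Tactic.RingSolver using (solve-∀)
open import Data.Fin using () renaming (zero to fz; suc to fs)
open import Data.Vec using (Vec)
open import Data.List using (List; []; _∷_; _++_; map)
open import Data.List.Properties using (map-++)
open import Data.List.Membership.Propositional using (_∈_; _∉_)
open import Data.List.Membership.Propositional.Properties using (∈-++⁺ˡ; ∈-++⁺ʳ)
open import Data.List.Relation.Unary.Any using (here; there)
open import Data.List.Relation.Unary.All.Properties using (All¬⇒¬Any)
open import Data.List.Relation.Unary.All using ([])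
open import Data.List.Relation.Unary.AllPairs using ([]; _∷_)
open import Data.List.Relation.Unary.Unique.Propositional using (Unique)
open import Data.List.Relation.Binary.Permutation.Propositional using (_↭_)
open import Data.List.Relation.Binary.Permutation.Propositional.Properties using (map⁺)
open import Data.Product using (_,_; proj₁; proj₂)
open import Function using (id; _∘_)
open import Relation.Nullary using (yes; no; contradiction)
open import Relation.Binary.PropositionalEquality
open ≡-Reasoning

private
  variable
    x y z s S T s′ S′ T′ : ℕ
    xs ys : List ℕ
    M N : Term
    Γ Δ Θ : Ctx
    A B C : Ty 0

δ : ℕ → ℕ → ℕ
δ z y with z ≟ y
... | yes _ = 1
... | no  _ = 0

δ-refl : ∀ x → δ x x ≡ 1
δ-refl x with x ≟ x
... | yes _   = refl
... | no  x≢x = contradiction refl x≢x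

δ-≢ : z ≢ y → δ z y ≡ 0
δ-≢ {z} {y} z≢y with z ≟ y
... | yes z≡y = contradiction z≡y z≢y
... | no  _   = refl

occ : ℕ → Term → ℕ
occ z (fv y)    = δ z y
occ z (bv i)    = 0
occ z (lam M)   = occ z M
occ z (app M N) = occ z M + occ z N

mult : ℕ → List ℕ → ℕ
mult z xs = sum (map (δ z) xs)

mult-++ : ∀ z xs ys → mult z (xs ++ ys) ≡ mult z xs + mult z ys
mult-++ z xs ys = trans (cong sum (map-++ (δ z) xs ys)) (sum-++ (map (δ z) xs) _)

mult-↭ : xs ↭ ys → mult z xs ≡ mult z ys
mult-↭ p = sum-↭ (map⁺ _ p)

mult-∉ : z ∉ xs → mult z xs ≡ 0
mult-∉ {xs = []}     _   = refl
mult-∉ {xs = y ∷ ys} z∉ = cong₂ _+_ (δ-≢ (z∉ ∘ here)) (mult-∉ (z∉ ∘ there))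

occ-∉ : ∀ M → z ∉ fvs M → occ z M ≡ 0
occ-∉ (fv y)    z∉ = δ-≢ (z∉ ∘ here)
occ-∉ (bv i)    z∉ = refl
occ-∉ (lam M)   z∉ = occ-∉ M z∉
occ-∉ (app M N) z∉ = cong₂ _+_ (occ-∉ M (z∉ ∘ ∈-++⁺ˡ)) (occ-∉ N (z∉ ∘ ∈-++⁺ʳ (fvs M)))

≤-maxList : ∀ xs → y ∈ xs → y ≤ maxList xs
≤-maxList (x ∷ xs) (here refl) = m≤m⊔n x (maxList xs)
≤-maxList (x ∷ xs) (there y∈) = ≤-trans (≤-maxList xs y∈) (m≤n⊔m x (maxList xs))

fresh-∉ : ∀ N → fresh N ∉ fvs N
fresh-∉ N fresh∈ = 1+n≰n (≤-maxList (fvs N) fresh∈)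

size-closeAt : ∀ k x M → size (closeAt k x M) ≡ size M
size-closeAt k x (fv y) with x ≟ y
... | yes _ = refl
... | no  _ = refl
size-closeAt k x (bv i)    = refl
size-closeAt k x (lam M)   = cong suc (size-closeAt (suc k) x M)
size-closeAt k x (app M N) =
  cong₂ (λ a b → suc (a + b)) (size-closeAt k x M) (size-closeAt k x N)

size-ƛ : ∀ x M → size (ƛ x ⇒ M) ≡ suc (size M)
size-ƛ x M = cong suc (size-closeAt 0 x M)

occ-closeAt-self : ∀ k x M → occ x (closeAt k x M) ≡ 0
occ-closeAt-self k x (fv y) with x ≟ y
... | yes _   = refl
... | no  x≢y = δ-≢ x≢y
occ-closeAt-self k x (bv i)    = refl
occ-closeAt-self k x (lam M)   = occ-closeAt-self (suc k) x M
occ-closeAt-self k x (app M N) = cong₂ _+_ (occ-closeAt-self k x M) (occ-closeAt-self k x N)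

occ-closeAt-≢ : z ≢ x → ∀ k M → occ z (closeAt k x M) ≡ occ z M
occ-closeAt-≢ {x = x} z≢x k (fv y) with x ≟ y
... | yes refl = sym (δ-≢ z≢x)
... | no  _    = refl
occ-closeAt-≢ z≢x k (bv i)    = refl
occ-closeAt-≢ z≢x k (lam M)   = occ-closeAt-≢ z≢x (suc k) M
occ-closeAt-≢ z≢x k (app M N) = cong₂ _+_ (occ-closeAt-≢ z≢x k M) (occ-closeAt-≢ z≢x k N)

occ-[/]-self : ∀ x P M → occ x (M [ P / x ]) ≡ occ x M * occ x P
occ-[/]-self x P (fv y) with x ≟ y
... | yes refl = sym (*-identityˡ (occ x P))
... | no  x≢y  = δ-≢ x≢y
occ-[/]-self x P (bv i)    = refl
occ-[/]-self x P (lam M)   = occ-[/]-self x P M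
occ-[/]-self x P (app M N) =
  trans (cong₂ _+_ (occ-[/]-self x P M) (occ-[/]-self x P N))
        (sym (*-distribʳ-+ (occ x P) (occ x M) (occ x N)))

occ-[/]-≢ : z ≢ x → ∀ P M → occ z (M [ P / x ]) ≡ occ z M + occ x M * occ z P
occ-[/]-≢ {z} {x} z≢x P (fv y) with x ≟ y
... | yes refl = trans (sym (*-identityˡ (occ z P))) (cong (_+ (1 * occ z P)) (sym (δ-≢ z≢x)))
... | no  _    = sym (+-identityʳ _)
occ-[/]-≢ z≢x P (bv i)    = refl
occ-[/]-≢ z≢x P (lam M)   = occ-[/]-≢ z≢x P M
occ-[/]-≢ {z} {x} z≢x P (app M N) =
  trans (cong₂ _+_ (occ-[/]-≢ z≢x P M) (occ-[/]-≢ z≢x P N))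
        (distribute (occ z M) (occ z N) (occ x M) (occ x N) (occ z P))
  where
  distribute : ∀ a b c d p → (a + c * p) + (b + d * p) ≡ (a + b) + (c + d) * p
  distribute = solve-∀

size-[/] : ∀ x P M → size (M [ P / x ]) + occ x M ≡ size M + occ x M * size P
size-[/] x P (fv y) with x ≟ y
... | yes refl = trans (+-comm (size P) 1) (cong suc (sym (*-identityˡ (size P))))
... | no  _    = refl
size-[/] x P (bv i)    = refl
size-[/] x P (lam M)   = cong suc (size-[/] x P M)
size-[/] x P (app M N) = begin
  suc (size (M [ P / x ]) + size (N [ P / x ])) + (occ x M + occ x N)
    ≡⟨ interchange (size (M [ P / x ])) (size (N [ P / x ])) (occ x M) (occ x N) ⟩
  suc ((size (M [ P / x ]) + occ x M) + (size (N [ P / x ]) + occ x N))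
    ≡⟨ cong₂ (λ a b → suc (a + b)) (size-[/] x P M) (size-[/] x P N) ⟩
  suc ((size M + occ x M * size P) + (size N + occ x N * size P))
    ≡⟨ distribute (size M) (size N) (occ x M) (occ x N) (size P) ⟩
  suc (size M + size N) + (occ x M + occ x N) * size P ∎
  where
  interchange : ∀ a b c d → suc (a + b) + (c + d) ≡ suc ((a + c) + (b + d))
  interchange = solve-∀
  distribute : ∀ a b c d p → suc ((a + c * p) + (b + d * p)) ≡ suc (a + b) + (c + d) * p
  distribute = solve-∀

size-[app/] : ∀ x y N M → occ x M ≡ 1 → size (M [ app (fv y) N / x ]) ≡ suc (size N + size M)
size-[app/] x y N M occ≡1 = +-cancelʳ-≡ 1 _ _ (begin
  size (M [ yN / x ]) + 1          ≡⟨ cong (size (M [ yN / x ]) +_) (sym occ≡1) ⟩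
  size (M [ yN / x ]) + occ x M    ≡⟨ size-[/] x yN M ⟩
  size M + occ x M * size yN       ≡⟨ cong (λ o → size M + o * size yN) occ≡1 ⟩
  size M + 1 * suc (suc (size N))  ≡⟨ rearrange (size M) (size N) ⟩
  suc (size N + size M) + 1        ∎)
  where
  yN : Term
  yN = app (fv y) N
  rearrange : ∀ m n → m + 1 * suc (suc n) ≡ suc (n + m) + 1
  rearrange = solve-∀

arrows : ∀ {n} → Ty n → ℕ
arrows (fvar a) = 0
arrows (bvar i) = 0
arrows (A ⊸ B)  = suc (arrows A + arrows B)
arrows (all A)  = arrows A

tsize-stripEnv : ∀ {n} base (env : Vec ℕ n) (A : Ty n) →
                 tsize (stripEnv base env A) ≡ suc (2 * arrows A)
tsize-stripEnv base env (fvar a) = refl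
tsize-stripEnv base env (bvar i) = refl
tsize-stripEnv base env (A ⊸ B)  = begin
  suc (tsize (stripEnv base env A) + tsize (stripEnv base env B))
    ≡⟨ cong₂ (λ a b → suc (a + b)) (tsize-stripEnv base env A) (tsize-stripEnv base env B) ⟩
  suc (suc (2 * arrows A) + suc (2 * arrows B))
    ≡⟨ double (arrows A) (arrows B) ⟩
  suc (2 * arrows (A ⊸ B)) ∎
  where
  double : ∀ a b → suc (suc (2 * a) + suc (2 * b)) ≡ suc (2 * suc (a + b))
  double = solve-∀
tsize-stripEnv base env (all A) = tsize-stripEnv base _ A

tsize-⁻ : ∀ A → tsize (A ⁻) ≡ suc (2 * arrows A)
tsize-⁻ A = tsize-stripEnv _ _ A

tsize-⁻-⊸ : ∀ A B → tsize ((A ⊸ B) ⁻) ≡ suc (tsize (A ⁻) + tsize (B ⁻))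
tsize-⁻-⊸ A B = begin
  tsize ((A ⊸ B) ⁻)
    ≡⟨ tsize-⁻ (A ⊸ B) ⟩
  suc (2 * suc (arrows A + arrows B))
    ≡⟨ split (arrows A) (arrows B) ⟩
  suc (suc (2 * arrows A) + suc (2 * arrows B))
    ≡⟨ cong₂ (λ a b → suc (a + b)) (sym (tsize-⁻ A)) (sym (tsize-⁻ B)) ⟩
  suc (tsize (A ⁻) + tsize (B ⁻)) ∎
  where
  split : ∀ a b → suc (2 * suc (a + b)) ≡ suc (suc (2 * a) + suc (2 * b))
  split = solve-∀

weakenTy-fvar : ∀ {n} γ → weakenTy {n} (fvar γ) ≡ fvar γ
weakenTy-fvar {zero}  γ = refl
weakenTy-fvar {suc n} γ = cong wk1 (weakenTy-fvar {n} γ)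

arrows-inst-fvar : ∀ {n} (A : Ty (suc n)) γ → arrows (inst A (fvar γ)) ≡ arrows A
arrows-inst-fvar (fvar a)      γ = refl
arrows-inst-fvar {n} (bvar fz) γ = cong arrows (weakenTy-fvar {n} γ)
arrows-inst-fvar (bvar (fs i)) γ = refl
arrows-inst-fvar (A ⊸ B)       γ = cong₂ (λ a b → suc (a + b)) (arrows-inst-fvar A γ) (arrows-inst-fvar B γ)
arrows-inst-fvar (all A)       γ = arrows-inst-fvar A γ

tsize-⁻-∀ : ∀ (A : Ty 1) γ → tsize (all A ⁻) ≡ tsize (inst A (fvar γ) ⁻)
tsize-⁻-∀ A γ = begin
  tsize (all A ⁻)                    ≡⟨ tsize-⁻ (all A) ⟩
  suc (2 * arrows A)                 ≡⟨ cong (λ a → suc (2 * a)) (sym (arrows-inst-fvar A γ)) ⟩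
  suc (2 * arrows (inst A (fvar γ))) ≡⟨ sym (tsize-⁻ (inst A (fvar γ))) ⟩
  tsize (inst A (fvar γ) ⁻)          ∎

size-η : ∀ {n} (A : Ty n) N → size (η A N) ≡ size N + 3 * arrows A
size-η (fvar a) N = sym (+-identityʳ (size N))
size-η (bvar i) N = sym (+-identityʳ (size N))
size-η (all A)  N = size-η A N
size-η (C ⊸ D)  N = begin
  size (ƛ v ⇒ η D (app N (η C (fv v))))
    ≡⟨ size-ƛ v _ ⟩
  suc (size (η D (app N (η C (fv v)))))
    ≡⟨ cong suc (size-η D _) ⟩
  suc (suc (size N + size (η C (fv v))) + 3 * arrows D)
    ≡⟨ cong (λ c → suc (suc (size N + c) + 3 * arrows D)) (size-η C (fv v)) ⟩
  suc (suc (size N + suc (3 * arrows C)) + 3 * arrows D)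
    ≡⟨ collect (size N) (arrows C) (arrows D) ⟩
  size N + 3 * arrows (C ⊸ D) ∎
  where
  v : ℕ
  v = fresh N
  collect : ∀ n c d → suc (suc (n + suc (3 * c)) + 3 * d) ≡ n + 3 * suc (c + d)
  collect = solve-∀

occ-η : ∀ {n} (A : Ty n) N z → occ z (η A N) ≡ occ z N
occ-η (fvar a) N z = refl
occ-η (bvar i) N z = refl
occ-η (all A)  N z = occ-η A N z
occ-η (C ⊸ D)  N z with z ≟ fresh N
... | yes refl = trans (occ-closeAt-self 0 z (η D (app N (η C (fv z)))))
                      (sym (occ-∉ N (fresh-∉ N)))
... | no  z≢v  = begin
  occ z (closeAt 0 v (η D (app N (η C (fv v))))) ≡⟨ occ-closeAt-≢ z≢v 0 (η D (app N (η C (fv v)))) ⟩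
  occ z (η D (app N (η C (fv v))))               ≡⟨ occ-η D _ z ⟩
  occ z N + occ z (η C (fv v))                   ≡⟨ cong (occ z N +_) (occ-η C (fv v) z) ⟩
  occ z N + δ z v                                ≡⟨ cong (occ z N +_) (δ-≢ z≢v) ⟩
  occ z N + 0                                    ≡⟨ +-identityʳ (occ z N) ⟩
  occ z N                                        ∎
  where
  v : ℕ
  v = fresh N

record Linear (xs : List ℕ) (M : Term) : Set where
  constructor linearity
  field occ≡mult : ∀ z → occ z M ≡ mult z xs
open Linear

Linear-head : Linear (x ∷ xs) M → x ∉ xs → occ x M ≡ 1
Linear-head {x} lin x∉ = trans (occ≡mult lin x) (cong₂ _+_ (δ-refl x) (mult-∉ x∉))

Linear-↭ : xs ↭ ys → Linear ys M → Linear xs M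
Linear-↭ xs↭ys lin = linearity λ z → trans (occ≡mult lin z) (sym (mult-↭ xs↭ys))

Linear-fv : ∀ x → Linear (x ∷ []) (fv x)
Linear-fv x = linearity λ z → sym (+-identityʳ (δ z x))

Linear-app-fv : Linear xs N → Linear (y ∷ xs) (app (fv y) N)
Linear-app-fv {y = y} lin = linearity λ z → cong (δ z y +_) (occ≡mult lin z)

Linear-η : ∀ {n} (A : Ty n) → Linear xs N → Linear xs (η A N)
Linear-η A lin = linearity λ z → trans (occ-η A _ z) (occ≡mult lin z)

Linear-ƛ : Linear (x ∷ xs) M → x ∉ xs → Linear xs (ƛ x ⇒ M)
Linear-ƛ {x} {xs} {M} lin x∉ = linearity occ-ƛ
  where
  occ-ƛ : ∀ z → occ z (closeAt 0 x M) ≡ mult z xs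
  occ-ƛ z with z ≟ x
  ... | yes refl = trans (occ-closeAt-self 0 z M) (sym (mult-∉ x∉))
  ... | no  z≢x  = begin
    occ z (closeAt 0 x M) ≡⟨ occ-closeAt-≢ z≢x 0 M ⟩
    occ z M               ≡⟨ occ≡mult lin z ⟩
    δ z x + mult z xs     ≡⟨ cong (_+ mult z xs) (δ-≢ z≢x) ⟩
    mult z xs             ∎

Linear-[/] : Linear xs N → Linear (x ∷ ys) M → x ∉ ys → Linear (xs ++ ys) (M [ N / x ])
Linear-[/] {xs} {N} {x} {ys} {M} linN linM x∉ = linearity occ-[/]
  where
  occ-[/] : ∀ z → occ z (M [ N / x ]) ≡ mult z (xs ++ ys)
  occ-[/] z with z ≟ x
  ... | yes refl = begin
    occ z (M [ N / z ])   ≡⟨ occ-[/]-self z N M ⟩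
    occ z M * occ z N     ≡⟨ cong₂ _*_ (Linear-head linM x∉) (occ≡mult linN z) ⟩
    1 * mult z xs         ≡⟨ *-identityˡ (mult z xs) ⟩
    mult z xs             ≡⟨ sym (+-identityʳ (mult z xs)) ⟩
    mult z xs + 0         ≡⟨ cong (mult z xs +_) (sym (mult-∉ x∉)) ⟩
    mult z xs + mult z ys ≡⟨ sym (mult-++ z xs ys) ⟩
    mult z (xs ++ ys)     ∎
  ... | no  z≢x  = begin
    occ z (M [ N / x ])               ≡⟨ occ-[/]-≢ z≢x N M ⟩
    occ z M + occ x M * occ z N       ≡⟨ cong₂ (λ m o → m + o * occ z N) (occ≡mult linM z) (Linear-head linM x∉) ⟩
    (δ z x + mult z ys) + 1 * occ z N ≡⟨ cong₂ (λ d n → (d + mult z ys) + 1 * n) (δ-≢ z≢x) (occ≡mult linN z) ⟩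
    mult z ys + 1 * mult z xs         ≡⟨ cong (mult z ys +_) (*-identityˡ (mult z xs)) ⟩
    mult z ys + mult z xs             ≡⟨ +-comm (mult z ys) (mult z xs) ⟩
    mult z xs + mult z ys             ≡⟨ sym (mult-++ z xs ys) ⟩
    mult z (xs ++ ys)                 ∎

Unique-dom : Γ ⊢ M ∶ C → Unique (dom Γ)
Unique-dom (ax x A)       = [] ∷ []
Unique-dom (cut _ _ _ u)  = u
Unique-dom (⊸R d) with Unique-dom d
... | _ ∷ u = u
Unique-dom (⊸L _ _ _ u)   = u
Unique-dom (∀R γ d _ _)   = Unique-dom d
Unique-dom (∀L B d)       = Unique-dom d

head-∉ : ((x , A) ∷ Δ) ⊢ M ∶ C → x ∉ dom Δ
head-∉ d with Unique-dom d
... | x≢Δ ∷ _ = All¬⇒¬Any x≢Δ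

dom-↭-++ : ∀ Γ → Θ ↭ Γ ++ Δ → dom Θ ↭ dom Γ ++ dom Δ
dom-↭-++ {Θ} {Δ} Γ p = subst (dom Θ ↭_) (map-++ proj₁ Γ Δ) (map⁺ proj₁ p)

linear : (D : Γ ⊢ M ∶ C) → Linear (dom Γ) M
linear (ax x A)       = Linear-fv x
linear (cut {Γ = Γ} d e p _) =
  Linear-↭ (dom-↭-++ Γ p) (Linear-[/] (linear d) (linear e) (head-∉ e))
linear (⊸R d)         = Linear-ƛ (linear d) (head-∉ d)
linear (⊸L {Γ = Γ} {A = A} {B = B} {y = y} d e p _) =
  Linear-↭ (dom-↭-++ ((y , A ⊸ B) ∷ Γ) p) (Linear-[/] (Linear-app-fv (linear d)) (linear e) (head-∉ e))
linear (∀R γ d _ _)   = linear d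
linear (∀L B d)       = linear d

linear-η : (D : Γ ⊢ M ∶ C) → Linear (dom Γ) (ηSubject D)
linear-η (ax x A)       = Linear-η A (Linear-fv x)
linear-η (cut {Γ = Γ} d e p _) =
  Linear-↭ (dom-↭-++ Γ p) (Linear-[/] (linear-η d) (linear-η e) (head-∉ e))
linear-η (⊸R d)         = Linear-ƛ (linear-η d) (head-∉ d)
linear-η (⊸L {Γ = Γ} {A = A} {B = B} {y = y} d e p _) =
  Linear-↭ (dom-↭-++ ((y , A ⊸ B) ∷ Γ) p) (Linear-[/] (Linear-app-fv (linear-η d)) (linear-η e) (head-∉ e))
linear-η (∀R γ d _ _)   = linear-η d
linear-η (∀L B d)       = linear-η d

ctxMinusSize≡sum : ∀ Γ → ctxMinusSize Γ ≡ sum (map (tsize ∘ _⁻ ∘ proj₂) Γ)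
ctxMinusSize≡sum []            = refl
ctxMinusSize≡sum ((x , A) ∷ Γ) = cong (tsize (A ⁻) +_) (ctxMinusSize≡sum Γ)

ctxMinusSize-↭ : Θ ↭ Γ → ctxMinusSize Θ ≡ ctxMinusSize Γ
ctxMinusSize-↭ {Θ} {Γ} p = begin
  ctxMinusSize Θ                      ≡⟨ ctxMinusSize≡sum Θ ⟩
  sum (map (tsize ∘ _⁻ ∘ proj₂) Θ)    ≡⟨ sum-↭ (map⁺ (tsize ∘ _⁻ ∘ proj₂) p) ⟩
  sum (map (tsize ∘ _⁻ ∘ proj₂) Γ)    ≡⟨ sym (ctxMinusSize≡sum Γ) ⟩
  ctxMinusSize Γ                      ∎

ctxMinusSize-++ : ∀ Γ Δ → ctxMinusSize (Γ ++ Δ) ≡ ctxMinusSize Γ + ctxMinusSize Δ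
ctxMinusSize-++ []            Δ = refl
ctxMinusSize-++ ((x , A) ∷ Γ) Δ =
  trans (cong (tsize (A ⁻) +_) (ctxMinusSize-++ Γ Δ)) (sym (+-assoc (tsize (A ⁻)) _ _))

sequentSize : Ctx → Ty 0 → ℕ
sequentSize Γ B = ctxMinusSize Γ + tsize (B ⁻)

sequentSize-ax : ∀ x A → sequentSize ((x , A) ∷ []) A ≡ 2 * suc (2 * arrows A)
sequentSize-ax x A = begin
  (tsize (A ⁻) + 0) + tsize (A ⁻)               ≡⟨ cong (λ t → (t + 0) + t) (tsize-⁻ A) ⟩
  (suc (2 * arrows A) + 0) + suc (2 * arrows A) ≡⟨ double (arrows A) ⟩
  2 * suc (2 * arrows A)                        ∎
  where
  double : ∀ a → (suc (2 * a) + 0) + suc (2 * a) ≡ 2 * suc (2 * a)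
  double = solve-∀

sequentSize-⊸R : ∀ Γ x A B → sequentSize Γ (A ⊸ B) ≡ suc (sequentSize ((x , A) ∷ Γ) B)
sequentSize-⊸R Γ x A B = begin
  ctxMinusSize Γ + tsize ((A ⊸ B) ⁻)                 ≡⟨ cong (ctxMinusSize Γ +_) (tsize-⁻-⊸ A B) ⟩
  ctxMinusSize Γ + suc (tsize (A ⁻) + tsize (B ⁻))    ≡⟨ move (ctxMinusSize Γ) (tsize (A ⁻)) (tsize (B ⁻)) ⟩
  suc ((tsize (A ⁻) + ctxMinusSize Γ) + tsize (B ⁻))  ∎
  where
  move : ∀ c a b → c + suc (a + b) ≡ suc ((a + c) + b)
  move = solve-∀

sequentSize-⊸L : ∀ Γ x Δ C → Θ ↭ (y , A ⊸ B) ∷ Γ ++ Δ →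
                 sequentSize Θ C ≡ suc (sequentSize Γ A + sequentSize ((x , B) ∷ Δ) C)
sequentSize-⊸L {Θ} {y} {A} {B} Γ x Δ C p = begin
  ctxMinusSize Θ + tsize (C ⁻)
    ≡⟨ cong (_+ tsize (C ⁻)) (ctxMinusSize-↭ p) ⟩
  (tsize ((A ⊸ B) ⁻) + ctxMinusSize (Γ ++ Δ)) + tsize (C ⁻)
    ≡⟨ cong₂ (λ t u → (t + u) + tsize (C ⁻)) (tsize-⁻-⊸ A B) (ctxMinusSize-++ Γ Δ) ⟩
  (suc (tsize (A ⁻) + tsize (B ⁻)) + (ctxMinusSize Γ + ctxMinusSize Δ)) + tsize (C ⁻)
    ≡⟨ regroup (tsize (A ⁻)) (tsize (B ⁻)) (ctxMinusSize Γ) (ctxMinusSize Δ) (tsize (C ⁻)) ⟩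
  suc ((ctxMinusSize Γ + tsize (A ⁻)) + ((tsize (B ⁻) + ctxMinusSize Δ) + tsize (C ⁻))) ∎
  where
  regroup : ∀ a b g d c → (suc (a + b) + (g + d)) + c ≡ suc ((g + a) + ((b + d) + c))
  regroup = solve-∀

sequentSize-∀R : ∀ Γ (A : Ty 1) γ → sequentSize Γ (all A) ≡ sequentSize Γ (inst A (fvar γ))
sequentSize-∀R Γ A γ = cong (ctxMinusSize Γ +_) (tsize-⁻-∀ A γ)

Sandwich : ℕ → ℕ → ℕ → Set
Sandwich s S T = (s ≤ S) × (S ≤ T) × (T ≤ 2 * S)

Sandwich-resp : s ≡ s′ → S ≡ S′ → T ≡ T′ → Sandwich s S T → Sandwich s′ S′ T′
Sandwich-resp refl refl refl = id

Sandwich-axiom : ∀ k → Sandwich 1 (1 + 3 * k) (2 * suc (2 * k))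
Sandwich-axiom k =
  s≤s z≤n ,
  ≤-trans (m≤m+n (1 + 3 * k) (1 + k)) (≤-reflexive (regroup k)) ,
  *-monoʳ-≤ 2 (s≤s (*-monoˡ-≤ k {2} {3} (s≤s (s≤s z≤n))))
  where
  regroup : ∀ k → (1 + 3 * k) + (1 + k) ≡ 2 * suc (2 * k)
  regroup = solve-∀

Sandwich-suc : Sandwich s S T → Sandwich (suc s) (suc S) (suc T)
Sandwich-suc {S = S} (s≤S , S≤T , T≤2S) =
  s≤s s≤S ,
  s≤s S≤T ,
  ≤-trans (s≤s T≤2S) (≤-trans (n≤1+n _) (≤-reflexive (sym (*-suc 2 S))))

Sandwich-join : Sandwich s S T → Sandwich s′ S′ T′ →
                Sandwich (suc (s + s′)) (suc (S + S′)) (suc (T + T′))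
Sandwich-join {S = S} {S′ = S′} (s≤S , S≤T , T≤2S) (s′≤S′ , S′≤T′ , T′≤2S′) =
  s≤s (+-mono-≤ s≤S s′≤S′) ,
  s≤s (+-mono-≤ S≤T S′≤T′) ,
  ≤-trans (s≤s (+-mono-≤ T≤2S T′≤2S′)) (≤-trans (n≤1+n _) (≤-reflexive (distribute S S′)))
  where
  distribute : ∀ S S′ → suc (suc (2 * S + 2 * S′)) ≡ 2 * suc (S + S′)
  distribute = solve-∀

sandwich : (D : Γ ⊢ M ∶ B) → CutFree D → No∀L D →
           Sandwich (size M) (size (ηSubject D)) (sequentSize Γ B)
sandwich (ax x A) _ _ =
  Sandwich-resp refl (sym (size-η A (fv x))) (sym (sequentSize-ax x A)) (Sandwich-axiom (arrows A))
sandwich (cut _ _ _ _) () _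
sandwich (⊸R {Γ} {M} {A} {B} {x} d) cf no∀L =
  Sandwich-resp (sym (size-ƛ x M)) (sym (size-ƛ x (ηSubject d))) (sym (sequentSize-⊸R Γ x A B))
                (Sandwich-suc (sandwich d cf no∀L))
sandwich (⊸L {Γ = Γ} {Δ} {N} {M} {C = C} {x} {y} d e p _) (cfd , cfe) (no∀Ld , no∀Le) =
  Sandwich-resp (sym (size-[app/] x y N M (Linear-head (linear e) (head-∉ e))))
                (sym (size-[app/] x y (ηSubject d) (ηSubject e) (Linear-head (linear-η e) (head-∉ e))))
                (sym (sequentSize-⊸L Γ x Δ C p))
                (Sandwich-join (sandwich d cfd no∀Ld) (sandwich e cfe no∀Le))
sandwich (∀R {Γ} {A = A} γ d _ _) cf no∀L =
  Sandwich-resp refl refl (sym (sequentSize-∀R Γ A γ)) (sandwich d cf no∀L)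
sandwich (∀L B d) _ ()

lemmaA9 : ∀ {Γ M B} (D : Γ ⊢ M ∶ B) → CutFree D → No∀L D →
    (size M ≤ size (ηLong D)) ×
    (size (ηLong D) ≤ ctxMinusSize Γ + tsize (B ⁻)) ×
    (ctxMinusSize Γ + tsize (B ⁻) ≤ 2 * size (ηLong D))
lemmaA9 = sandwich
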